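{- Let $s\ge2$ and let $x_1,\dots,x_s$ be non-negative integers such that $\sum_{i=1}^j i x_i\le 2j+2$ for each $1\le j\le s$. Then $$\sum_{i=1}^s(s+1-i)x_i\le 4s+r(s+1)-2^{r+1}+2,$$ where $r=\lfloor\log_2 s\rfloor$. -}

module Defs where

open import Data.Nat using (ℕ; zero; suc; _+_; _*_)

sum1to : ℕ → (ℕ → ℕ) → ℕ
sum1to zero    f = 0
sum1to (suc n) f = sum1to n f + f (suc n)

-- Write X j = x 1 + ⋯ + x j. Summing by parts, the left-hand side is X 1 + ⋯ + X s, so it
-- suffices to show X j ≤ 4 + ⌊log₂ j⌋ and to evaluate Σ_{j ≤ s} ⌊log₂ j⌋ = r (s + 1) − 2^(r+1) + 2.
-- For the bound on X j, build x one unit at a time: adding a unit of weight a to a configuration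
-- of weight T is only allowed when T ≤ a + 2 (the constraint at j = a), so the least weight w m
-- of m units satisfies w (m + 1) ≥ 2 w m − 2 for m ≥ 3, i.e. w (3 + k) ≥ 2^k + 2.  Combined with
-- w (X j) ≤ Σ_{i ≤ j} i x i ≤ 2 j + 2 this gives X j ≤ 4 + ⌊log₂ j⌋.
module Submission where

open import Defs
open import Data.Nat using (ℕ; _+_; _*_; _∸_; _^_; _≤_)
open import Data.Nat.Logarithm using (⌊log₂_⌋)

open import Data.Nat.Base using (zero; suc; _<_; z≤n; s≤s; ⌊_/2⌋)
open import Data.Nat.Properties
open import Data.Nat.Logarithm using (⌊log₂⌋-mono-≤; ⌊log₂[2^n]⌋≡n)
open import Data.Nat.Logarithm.Core using (⌊log2⌋)
open import Data.Nat.Induction using (<-wellFounded)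
open import Data.Nat.Tactic.RingSolver using (solve-∀)
open import Data.Sum using (_⊎_; inj₁; inj₂; [_,_]′)
open import Induction.WellFounded using (Acc; acc)
open import Relation.Binary.PropositionalEquality
open import Relation.Nullary using (yes; no)

sum1to-cong : ∀ n {f g : ℕ → ℕ} → (∀ i → i ≤ n → f i ≡ g i) → sum1to n f ≡ sum1to n g
sum1to-cong zero    f≗g = refl
sum1to-cong (suc n) f≗g =
  cong₂ _+_ (sum1to-cong n (λ i i≤n → f≗g i (m≤n⇒m≤1+n i≤n))) (f≗g (suc n) ≤-refl)

sum1to-mono-≤ : ∀ n {f g : ℕ → ℕ} → (∀ i → 1 ≤ i → i ≤ n → f i ≤ g i) →
                sum1to n f ≤ sum1to n g
sum1to-mono-≤ zero    f≤g = z≤n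
sum1to-mono-≤ (suc n) f≤g =
  +-mono-≤ (sum1to-mono-≤ n (λ i 1≤i i≤n → f≤g i 1≤i (m≤n⇒m≤1+n i≤n)))
           (f≤g (suc n) (s≤s z≤n) ≤-refl)

sum1to-distrib-+ : ∀ n (f g : ℕ → ℕ) →
                   sum1to n (λ i → f i + g i) ≡ sum1to n f + sum1to n g
sum1to-distrib-+ zero    f g = refl
sum1to-distrib-+ (suc n) f g = begin
  sum1to n (λ i → f i + g i) + (f (suc n) + g (suc n))
    ≡⟨ cong (_+ (f (suc n) + g (suc n))) (sum1to-distrib-+ n f g) ⟩
  sum1to n f + sum1to n g + (f (suc n) + g (suc n))
    ≡⟨ +-assoc-comm (sum1to n f) (sum1to n g) (f (suc n)) (g (suc n)) ⟩
  sum1to n f + f (suc n) + (sum1to n g + g (suc n)) ∎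
  where
  open ≡-Reasoning
  +-assoc-comm : ∀ a b c d → a + b + (c + d) ≡ a + c + (b + d)
  +-assoc-comm = solve-∀

sum1to-const : ∀ n c → sum1to n (λ _ → c) ≡ c * n
sum1to-const zero    c = sym (*-zeroʳ c)
sum1to-const (suc n) c = begin
  sum1to n (λ _ → c) + c ≡⟨ cong (_+ c) (sum1to-const n c) ⟩
  c * n + c             ≡⟨ +-comm (c * n) c ⟩
  c + c * n             ≡⟨ sym (*-suc c n) ⟩
  c * suc n             ∎
  where open ≡-Reasoning

sum1to-[n+1∸i]*≡sum1to-sum1to : ∀ n (f : ℕ → ℕ) →
  sum1to n (λ i → (n + 1 ∸ i) * f i) ≡ sum1to n (λ j → sum1to j f)
sum1to-[n+1∸i]*≡sum1to-sum1to zero    f = refl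
sum1to-[n+1∸i]*≡sum1to-sum1to (suc n) f = begin
  sum1to n (λ i → (suc n + 1 ∸ i) * f i) + (suc n + 1 ∸ suc n) * f (suc n)
    ≡⟨ cong₂ _+_ (sum1to-cong n peel) last ⟩
  sum1to n (λ i → f i + (n + 1 ∸ i) * f i) + f (suc n)
    ≡⟨ cong (_+ f (suc n)) (sum1to-distrib-+ n f _) ⟩
  sum1to n f + sum1to n (λ i → (n + 1 ∸ i) * f i) + f (suc n)
    ≡⟨ cong (λ t → sum1to n f + t + f (suc n)) (sum1to-[n+1∸i]*≡sum1to-sum1to n f) ⟩
  sum1to n f + sum1to n (λ j → sum1to j f) + f (suc n)
    ≡⟨ rotate (sum1to n f) _ (f (suc n)) ⟩
  sum1to n (λ j → sum1to j f) + (sum1to n f + f (suc n)) ∎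
  where
  open ≡-Reasoning
  peel : ∀ i → i ≤ n → (suc n + 1 ∸ i) * f i ≡ f i + (n + 1 ∸ i) * f i
  peel i i≤n = cong (_* f i) (+-∸-assoc 1 (≤-trans i≤n (m≤m+n n 1)))
  last : (suc n + 1 ∸ suc n) * f (suc n) ≡ f (suc n)
  last = trans (cong (_* f (suc n)) (m+n∸m≡n (suc n) 1)) (*-identityˡ (f (suc n)))
  rotate : ∀ a b c → a + b + c ≡ b + (a + c)
  rotate = solve-∀

-- The least weight Σ i · x i of an admissible configuration with Σ x i = m; it is attained
-- greedily by x 1 = 4 and x 2 = x 4 = x 8 = ⋯ = 1.
leastWeight : ℕ → ℕ
leastWeight (suc (suc (suc k))) = 2 ^ k + 2
leastWeight m                   = m

leastWeight-suc : ∀ {m T a} → 1 ≤ a → T ≤ a + 2 → leastWeight m ≤ T →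
                  leastWeight (suc m) ≤ T + a
leastWeight-suc {0}                         1≤a _     w≤T = +-mono-≤ w≤T 1≤a
leastWeight-suc {1}                         1≤a _     w≤T = +-mono-≤ w≤T 1≤a
leastWeight-suc {2}                         1≤a _     w≤T = +-mono-≤ w≤T 1≤a
leastWeight-suc {suc (suc (suc k))} {T} {a} _   T≤a+2 w≤T = begin
  2 * 2 ^ k + 2     ≡⟨ double (2 ^ k) ⟩
  2 ^ k + 2 + 2 ^ k ≤⟨ +-mono-≤ w≤T 2^k≤a ⟩
  T + a             ∎
  where
  open ≤-Reasoning
  2^k≤a : 2 ^ k ≤ a
  2^k≤a = +-cancelʳ-≤ 2 (2 ^ k) a (≤-trans w≤T T≤a+2)
  double : ∀ v → 2 * v + 2 ≡ v + 2 + v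
  double = solve-∀

leastWeight-+ : ∀ m n {T a} → 1 ≤ a → T + a * n ≤ 2 * a + 2 → leastWeight m ≤ T →
                leastWeight (m + n) ≤ T + a * n
leastWeight-+ m zero {T} {a} _ _ w≤T = begin
  leastWeight (m + 0) ≡⟨ cong leastWeight (+-identityʳ m) ⟩
  leastWeight m       ≤⟨ w≤T ⟩
  T                   ≤⟨ m≤m+n T (a * 0) ⟩
  T + a * 0           ∎
  where open ≤-Reasoning
leastWeight-+ m (suc n) {T} {a} 1≤a bound w≤T = begin
  leastWeight (m + suc n) ≡⟨ cong leastWeight (+-suc m n) ⟩
  leastWeight (suc m + n) ≤⟨ leastWeight-+ (suc m) n 1≤a bound′ w[1+m]≤T+a ⟩
  T + a + a * n           ≡⟨ regroup ⟩
  T + a * suc n           ∎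
  where
  open ≤-Reasoning
  regroup : T + a + a * n ≡ T + a * suc n
  regroup = trans (+-assoc T a (a * n)) (cong (T +_) (sym (*-suc a n)))
  bound′ : T + a + a * n ≤ 2 * a + 2
  bound′ = subst (_≤ 2 * a + 2) (sym regroup) bound
  T≤a+2 : T ≤ a + 2
  T≤a+2 = +-cancelʳ-≤ a T (a + 2) (begin
    T + a         ≤⟨ m≤m+n (T + a) (a * n) ⟩
    T + a + a * n ≤⟨ bound′ ⟩
    2 * a + 2     ≡⟨ twice a ⟩
    a + 2 + a     ∎)
    where
    twice : ∀ a → 2 * a + 2 ≡ a + 2 + a
    twice = solve-∀
  w[1+m]≤T+a : leastWeight (suc m) ≤ T + a
  w[1+m]≤T+a = leastWeight-suc {m} 1≤a T≤a+2 w≤T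

leastWeight-sum1to : ∀ s (x : ℕ → ℕ) →
  ((j : ℕ) → 1 ≤ j → j ≤ s → sum1to j (λ i → i * x i) ≤ 2 * j + 2) →
  ∀ j → j ≤ s → leastWeight (sum1to j x) ≤ sum1to j (λ i → i * x i)
leastWeight-sum1to s x admissible zero    _     = z≤n
leastWeight-sum1to s x admissible (suc j) 1+j≤s =
  leastWeight-+ (sum1to j x) (x (suc j)) (s≤s z≤n) (admissible (suc j) (s≤s z≤n) 1+j≤s)
    (leastWeight-sum1to s x admissible j (<⇒≤ 1+j≤s))

2^k≤n⇒k≤⌊log₂n⌋ : ∀ {k n} → 2 ^ k ≤ n → k ≤ ⌊log₂ n ⌋
2^k≤n⇒k≤⌊log₂n⌋ {k} 2^k≤n = subst (_≤ _) (⌊log₂[2^n]⌋≡n k) (⌊log₂⌋-mono-≤ 2^k≤n)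

leastWeight≤2n+2⇒≤4+⌊log₂n⌋ : ∀ m n → leastWeight m ≤ 2 * n + 2 → m ≤ 4 + ⌊log₂ n ⌋
leastWeight≤2n+2⇒≤4+⌊log₂n⌋ 0 n _ = z≤n
leastWeight≤2n+2⇒≤4+⌊log₂n⌋ 1 n _ = s≤s z≤n
leastWeight≤2n+2⇒≤4+⌊log₂n⌋ 2 n _ = s≤s (s≤s z≤n)
leastWeight≤2n+2⇒≤4+⌊log₂n⌋ 3 n _ = s≤s (s≤s (s≤s z≤n))
leastWeight≤2n+2⇒≤4+⌊log₂n⌋ (suc (suc (suc (suc k)))) n w≤ =
  +-monoʳ-≤ 4 (2^k≤n⇒k≤⌊log₂n⌋ {n = n} (*-cancelˡ-≤ 2 (+-cancelʳ-≤ 2 (2 * 2 ^ k) (2 * n) w≤)))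

sum1to≤4+⌊log₂⌋ : ∀ s (x : ℕ → ℕ) →
  ((j : ℕ) → 1 ≤ j → j ≤ s → sum1to j (λ i → i * x i) ≤ 2 * j + 2) →
  ∀ j → 1 ≤ j → j ≤ s → sum1to j x ≤ 4 + ⌊log₂ j ⌋
sum1to≤4+⌊log₂⌋ s x admissible j 1≤j j≤s = leastWeight≤2n+2⇒≤4+⌊log₂n⌋ (sum1to j x) j
  (≤-trans (leastWeight-sum1to s x admissible j j≤s) (admissible j 1≤j j≤s))

2*⌊n/2⌋≤n : ∀ n → 2 * ⌊ n /2⌋ ≤ n
2*⌊n/2⌋≤n 0             = z≤n
2*⌊n/2⌋≤n 1             = z≤n
2*⌊n/2⌋≤n (suc (suc n)) =
  subst (_≤ 2 + n) (sym (*-suc 2 ⌊ n /2⌋)) (s≤s (s≤s (2*⌊n/2⌋≤n n)))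

n<2*[1+⌊n/2⌋] : ∀ n → n < 2 * suc ⌊ n /2⌋
n<2*[1+⌊n/2⌋] 0             = s≤s z≤n
n<2*[1+⌊n/2⌋] 1             = s≤s (s≤s z≤n)
n<2*[1+⌊n/2⌋] (suc (suc n)) =
  subst (3 + n ≤_) (sym (*-suc 2 (suc ⌊ n /2⌋))) (s≤s (s≤s (n<2*[1+⌊n/2⌋] n)))

2^⌊log2⌋[1+n]≤1+n : ∀ n (rec : Acc _<_ (suc n)) → 2 ^ ⌊log2⌋ (suc n) rec ≤ suc n
2^⌊log2⌋[1+n]≤1+n zero    _        = ≤-refl
2^⌊log2⌋[1+n]≤1+n (suc n) (acc rs) = begin
  2 * 2 ^ ⌊log2⌋ (suc ⌊ n /2⌋) _ ≤⟨ *-monoʳ-≤ 2 (2^⌊log2⌋[1+n]≤1+n ⌊ n /2⌋ _) ⟩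
  2 * suc ⌊ n /2⌋               ≤⟨ 2*⌊n/2⌋≤n (2 + n) ⟩
  2 + n                         ∎
  where open ≤-Reasoning

n<2^[1+⌊log2⌋n] : ∀ n (rec : Acc _<_ n) → n < 2 ^ suc (⌊log2⌋ n rec)
n<2^[1+⌊log2⌋n] 0             _        = s≤s z≤n
n<2^[1+⌊log2⌋n] 1             _        = s≤s (s≤s z≤n)
n<2^[1+⌊log2⌋n] (suc (suc n)) (acc rs) = begin-strict
  2 + n                                <⟨ n<2*[1+⌊n/2⌋] (2 + n) ⟩
  2 * suc (suc ⌊ n /2⌋)                ≤⟨ *-monoʳ-≤ 2 (n<2^[1+⌊log2⌋n] (suc ⌊ n /2⌋) _) ⟩
  2 * 2 ^ suc (⌊log2⌋ (suc ⌊ n /2⌋) _) ∎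
  where open ≤-Reasoning

⌊log₂[1+n]⌋≡⌊log₂n⌋⊎1+n≡2^[1+⌊log₂n⌋] : ∀ n →
  ⌊log₂ suc n ⌋ ≡ ⌊log₂ n ⌋ ⊎ suc n ≡ 2 ^ suc ⌊log₂ n ⌋
⌊log₂[1+n]⌋≡⌊log₂n⌋⊎1+n≡2^[1+⌊log₂n⌋] n with ⌊log₂ suc n ⌋ ≤? ⌊log₂ n ⌋
... | yes ≤-log = inj₁ (≤-antisym ≤-log (⌊log₂⌋-mono-≤ (n≤1+n n)))
... | no  ≰-log = inj₂ (≤-antisym
  (n<2^[1+⌊log2⌋n] n (<-wellFounded n))
  (≤-trans (^-monoʳ-≤ 2 (≰⇒> ≰-log)) (2^⌊log2⌋[1+n]≤1+n n (<-wellFounded (suc n)))))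

sum1to-⌊log₂⌋ : ∀ n → sum1to (suc n) (λ j → ⌊log₂ j ⌋) + 2 ^ (⌊log₂ suc n ⌋ + 1)
                      ≡ ⌊log₂ suc n ⌋ * (suc n + 1) + 2
sum1to-⌊log₂⌋ zero    = refl
sum1to-⌊log₂⌋ (suc n) =
  [ unchanged , doubled ]′ (⌊log₂[1+n]⌋≡⌊log₂n⌋⊎1+n≡2^[1+⌊log₂n⌋] (suc n))
  where
  open ≡-Reasoning
  L r P : ℕ
  L = sum1to (suc n) (λ j → ⌊log₂ j ⌋)
  r = ⌊log₂ suc n ⌋
  P = 2 ^ (r + 1)

  Goal : ℕ → Set
  Goal ρ = L + ρ + 2 ^ (ρ + 1) ≡ ρ * (2 + n + 1) + 2

  unchanged : ⌊log₂ 2 + n ⌋ ≡ r → Goal ⌊log₂ 2 + n ⌋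
  unchanged log≡r = subst Goal (sym log≡r) (begin
    L + r + P               ≡⟨ swap L r P ⟩
    L + P + r               ≡⟨ cong (_+ r) (sum1to-⌊log₂⌋ n) ⟩
    r * (1 + n + 1) + 2 + r ≡⟨ grow r n ⟩
    r * (2 + n + 1) + 2     ∎)
    where
    swap : ∀ a b c → a + b + c ≡ a + c + b
    swap = solve-∀
    grow : ∀ r n → r * (1 + n + 1) + 2 + r ≡ r * (2 + n + 1) + 2
    grow = solve-∀

  doubled : 2 + n ≡ 2 ^ suc r → Goal ⌊log₂ 2 + n ⌋
  doubled 2+n≡2^[1+r] = subst Goal (sym log≡1+r) (begin
    L + suc r + 2 * P                       ≡⟨ regroup L r P ⟩
    L + P + (suc r + P)                     ≡⟨ cong₂ _+_ (sum1to-⌊log₂⌋ n) (cong (suc r +_) P≡2+n) ⟩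
    r * (1 + n + 1) + 2 + (suc r + (2 + n)) ≡⟨ grow r n ⟩
    suc r * (2 + n + 1) + 2                 ∎)
    where
    log≡1+r : ⌊log₂ 2 + n ⌋ ≡ suc r
    log≡1+r = trans (cong ⌊log₂_⌋ 2+n≡2^[1+r]) (⌊log₂[2^n]⌋≡n (suc r))
    P≡2+n : P ≡ 2 + n
    P≡2+n = trans (cong (2 ^_) (+-comm r 1)) (sym 2+n≡2^[1+r])
    regroup : ∀ a b c → a + suc b + 2 * c ≡ a + c + (suc b + c)
    regroup = solve-∀
    grow : ∀ r n → r * (1 + n + 1) + 2 + (suc r + (2 + n)) ≡ suc r * (2 + n + 1) + 2
    grow = solve-∀

lemma13 : (s : ℕ) → 2 ≤ s → (x : ℕ → ℕ) →
    ((j : ℕ) → 1 ≤ j → j ≤ s → sum1to j (λ i → i * x i) ≤ 2 * j + 2) →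
    sum1to s (λ i → (s + 1 ∸ i) * x i) + 2 ^ (⌊log₂ s ⌋ + 1)
      ≤ 4 * s + ⌊log₂ s ⌋ * (s + 1) + 2
lemma13 zero      () _ _
lemma13 s@(suc t) _  x admissible = begin
  sum1to s (λ i → (s + 1 ∸ i) * x i) + P
    ≡⟨ cong (_+ P) (sum1to-[n+1∸i]*≡sum1to-sum1to s x) ⟩
  sum1to s (λ j → sum1to j x) + P
    ≤⟨ +-monoˡ-≤ P (sum1to-mono-≤ s (sum1to≤4+⌊log₂⌋ s x admissible)) ⟩
  sum1to s (λ j → 4 + ⌊log₂ j ⌋) + P
    ≡⟨ cong (_+ P) (sum1to-distrib-+ s (λ _ → 4) (λ j → ⌊log₂ j ⌋)) ⟩
  sum1to s (λ _ → 4) + L + P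
    ≡⟨ cong (λ c → c + L + P) (sum1to-const s 4) ⟩
  4 * s + L + P
    ≡⟨ +-assoc (4 * s) L P ⟩
  4 * s + (L + P)
    ≡⟨ cong (4 * s +_) (sum1to-⌊log₂⌋ t) ⟩
  4 * s + (⌊log₂ s ⌋ * (s + 1) + 2)
    ≡⟨ +-assoc (4 * s) (⌊log₂ s ⌋ * (s + 1)) 2 ⟨
  4 * s + ⌊log₂ s ⌋ * (s + 1) + 2 ∎
  where
  open ≤-Reasoning
  L P : ℕ
  L = sum1to s (λ j → ⌊log₂ j ⌋)
  P = 2 ^ (⌊log₂ s ⌋ + 1)
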